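{- Let $G$ be a finite simple graph with no isolated vertices. Then $Z(G)\leq Z(L(G))$.
   Context: For a finite simple graph $H$: colour each vertex black or white. A black vertex $v$ may force a white neighbour $w$ to become black if $w$ is the only white neighbour of $v$. A set $S\subseteq V(H)$ is a zero-forcing set if, colouring exactly the vertices of $S$ black and repeatedly applying this rule, all vertices eventually become black. The zero-forcing number $Z(H)$ is the minimum size of a zero-forcing set. $L(G)$ denotes the line graph of $G$: its vertices are the edges of $G$, two being adjacent iff they share an endpoint in $G$. -}

module Defs where

open import Data.Nat using (ℕ)
open import Data.Fin using (Fin; _<_)
open import Data.Bool using (Bool; T)
open import Data.Product using (Σ; ∃; _×_; _,_; proj₁)
open import Data.Sum using (_⊎_)
open import Data.List using (List; length)
open import Data.List.Membership.Propositional using (_∈_)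
open import Data.List.Relation.Unary.Unique.Propositional using (Unique)
open import Relation.Binary.PropositionalEquality using (_≡_; _≢_)
open import Relation.Nullary using (¬_)

record Graph (n : ℕ) : Set where
  field
    adj   : Fin n → Fin n → Bool
    sym   : ∀ u v → T (adj u v) → T (adj v u)
    irref : ∀ v → ¬ T (adj v v)
open Graph public

Adj : ∀ {n} → Graph n → Fin n → Fin n → Set
Adj G u v = T (adj G u v)

NoIsolated : ∀ {n} → Graph n → Set
NoIsolated {n} G = ∀ (v : Fin n) → ∃ λ u → Adj G v u

-- Black S w : w becomes black starting from the
-- black set S (a list of vertices) by repeatedly applying the colour-change
-- rule: a black vertex u forces its neighbour w once every other neighbour
-- of u is black.  The set of vertices derivable this way is exactly the
-- final coloured set of the forcing process.

data Black {V : Set} (A : V → V → Set) (S : List V) : V → Set where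
  initial : ∀ {v} → v ∈ S → Black A S v
  force   : ∀ {u w} → Black A S u → A u w
          → (∀ x → A u x → x ≢ w → Black A S x)
          → Black A S w

IsZeroForcingSet : {V : Set} → (V → V → Set) → List V → Set
IsZeroForcingSet A S = Unique S × (∀ v → Black A S v)

Edge : ∀ {n} → Graph n → Set
Edge {n} G = Σ (Fin n × Fin n) λ p → (proj₁ p < Data.Product.proj₂ p) × Adj G (proj₁ p) (Data.Product.proj₂ p)

endpoints : ∀ {n} {G : Graph n} → Edge G → Fin n × Fin n
endpoints (p , _) = p

ShareEndpoint : ∀ {n} → Fin n × Fin n → Fin n × Fin n → Set
ShareEndpoint (a , b) (c , d) = (a ≡ c ⊎ a ≡ d) ⊎ (b ≡ c ⊎ b ≡ d)

LineAdj : ∀ {n} (G : Graph n) → Edge G → Edge G → Set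
LineAdj G e f = endpoints {G = G} e ≢ endpoints {G = G} f
              × ShareEndpoint (endpoints {G = G} e) (endpoints {G = G} f)

-- Run the forcing process of L(G) inside G while keeping a ledger of paid
-- vertices (they will form the zero forcing set of G) and owed edges, starting
-- with nothing paid and the edges of T owed.  An edge is covered when both its
-- ends are forced by the paid vertices, or when it is owed.  If uv forces vw in
-- L(G), then every edge at u and every edge at v other than vw is covered.
-- Settle the owed ones by payments: an owed uv pays for u, every other owed edge
-- pays for its end away from u, resp. v.  Now u forces v, and v forces w.  Each
-- payment removes an owed edge, so |paid| + |owed| never grows.  Finally every
-- vertex of G, lying on some covered edge, is forced in the same way, and at
-- most |T| vertices have been paid.
module Submission where

open import Defs hiding (sym)
open import Data.Nat using (ℕ; _≤_; _+_; suc)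
open import Data.Nat.Properties using (≤-trans; ≤-reflexive; +-suc; +-assoc; +-monoʳ-≤; m≤m+n)
open import Data.Fin using (Fin)
open import Data.Fin.Properties using (_≟_; <-cmp; <-asym)
open import Data.Product using (Σ; ∃; _×_; _,_; proj₁; proj₂; swap)
open import Data.Product.Properties using (≡-dec)
open import Data.Sum using (_⊎_; inj₁; inj₂)
open import Data.Empty using (⊥-elim)
open import Data.List using (List; []; _∷_; length; map; _++_; filter; allFin; deduplicate)
open import Data.List.Properties using (length-map; length-++; filter-notAll; length-deduplicate)
open import Data.List.Relation.Unary.Any as Any using (Any; any?)
open import Data.List.Relation.Unary.All as All using (All; []; _∷_)
open import Data.List.Relation.Unary.Unique.DecPropositional.Properties using (deduplicate-!)
open import Data.List.Relation.Binary.Subset.Propositional using (_⊆_)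
open import Data.List.Membership.Propositional using (_∈_; find; lose)
open import Data.List.Membership.Propositional.Properties
  using (∈-map⁺; ∈-++⁺ˡ; ∈-++⁺ʳ; ∈-filter⁺; ∈-allFin; ∈-deduplicate⁺)
open import Relation.Binary using (tri<; tri≈; tri>; DecidableEquality)
open import Relation.Binary.PropositionalEquality
  using (_≡_; _≢_; refl; sym; trans; cong; subst; module ≡-Reasoning)
open import Relation.Nullary using (¬_; Dec; yes; no; ¬?)
open import Relation.Nullary.Decidable.Core using (T?; _×-dec_; _⊎-dec_)
open import Relation.Unary using (Decidable)
open import Relation.Unary.Properties using (∁?)

Black-mono : ∀ {V : Set} {A : V → V → Set} {S S′ : List V} →
             S ⊆ S′ → ∀ {v} → Black A S v → Black A S′ v
Black-mono S⊆S′ (initial v∈S)      = initial (S⊆S′ v∈S)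
Black-mono S⊆S′ (force bu u~w others) =
  force (Black-mono S⊆S′ bu) u~w (λ x u~x x≢w → Black-mono S⊆S′ (others x u~x x≢w))

length-filter-∁ : ∀ {A : Set} {P : A → Set} (P? : Decidable P) xs →
                  length (filter P? xs) + length (filter (∁? P?) xs) ≡ length xs
length-filter-∁ P? []       = refl
length-filter-∁ P? (x ∷ xs) with P? x
... | yes _ = cong suc (length-filter-∁ P? xs)
... | no  _ = trans (+-suc _ _) (cong suc (length-filter-∁ P? xs))

module UnorderedPair {A : Set} (_≟ᴬ_ : DecidableEquality A) where

  infix 4 _∼_ _∼?_

  _∼_ : A × A → A × A → Set
  p ∼ q = p ≡ q ⊎ p ≡ swap q

  ∼-sym : ∀ {p q} → p ∼ q → q ∼ p
  ∼-sym (inj₁ refl) = inj₁ refl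
  ∼-sym (inj₂ refl) = inj₂ refl

  ∼-trans : ∀ {p q r} → p ∼ q → q ∼ r → p ∼ r
  ∼-trans (inj₁ refl) q∼r         = q∼r
  ∼-trans (inj₂ refl) (inj₁ refl) = inj₂ refl
  ∼-trans (inj₂ refl) (inj₂ refl) = inj₁ refl

  ∼-swap : ∀ {p q} → p ∼ q → p ∼ swap q
  ∼-swap (inj₁ refl) = inj₂ refl
  ∼-swap (inj₂ refl) = inj₁ refl

  ∼-unique : ∀ {p a b c} → p ∼ (a , b) → p ∼ (a , c) → b ≡ c
  ∼-unique (inj₁ refl) (inj₁ refl) = refl
  ∼-unique (inj₁ refl) (inj₂ refl) = refl
  ∼-unique (inj₂ refl) (inj₁ refl) = refl
  ∼-unique (inj₂ refl) (inj₂ refl) = refl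

  ∼-endpoint : ∀ {p a b c d} → p ∼ (a , b) → p ∼ (c , d) → a ≡ c ⊎ a ≡ d
  ∼-endpoint (inj₁ refl) (inj₁ refl) = inj₁ refl
  ∼-endpoint (inj₁ refl) (inj₂ refl) = inj₂ refl
  ∼-endpoint (inj₂ refl) (inj₁ refl) = inj₂ refl
  ∼-endpoint (inj₂ refl) (inj₂ refl) = inj₁ refl

  ∼-apart : ∀ {p q a b c d} → p ∼ (a , b) → q ∼ (c , d) → a ≢ c → a ≢ d → p ≢ q
  ∼-apart p∼ab q∼cd a≢c a≢d refl with ∼-endpoint p∼ab q∼cd
  ... | inj₁ a≡c = a≢c a≡c
  ... | inj₂ a≡d = a≢d a≡d

  _∼?_ : ∀ p q → Dec (p ∼ q)
  p ∼? q = (p ≟² q) ⊎-dec (p ≟² swap q)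
    where _≟²_ = ≡-dec _≟ᴬ_ _≟ᴬ_

  -- the end of p other than z; junk when z is not an end of p
  opposite : A × A → A → A
  opposite (a , b) z with a ≟ᴬ z
  ... | yes _ = b
  ... | no  _ = a

  ∼-opposite : ∀ {p z y} → p ∼ (z , y) → opposite p z ≡ y
  ∼-opposite {z = z} (inj₁ refl) with z ≟ᴬ z
  ... | yes _   = refl
  ... | no  z≢z = ⊥-elim (z≢z refl)
  ∼-opposite {z = z} {y} (inj₂ refl) with y ≟ᴬ z
  ... | yes y≡z = sym y≡z
  ... | no  _   = refl

module _ {n : ℕ} where

  open UnorderedPair (_≟_ {n})

  ∼-share : ∀ {p q a b c} → p ∼ (a , b) → q ∼ (a , c) → ShareEndpoint p q
  ∼-share (inj₁ refl) (inj₁ refl) = inj₁ (inj₁ refl)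
  ∼-share (inj₁ refl) (inj₂ refl) = inj₁ (inj₂ refl)
  ∼-share (inj₂ refl) (inj₁ refl) = inj₂ (inj₁ refl)
  ∼-share (inj₂ refl) (inj₂ refl) = inj₂ (inj₂ refl)

  share-∼ : ∀ {p q} → ShareEndpoint p q → ∃ λ u → ∃ λ v → ∃ λ w → p ∼ (u , v) × q ∼ (v , w)
  share-∼ (inj₁ (inj₁ refl)) = _ , _ , _ , inj₂ refl , inj₁ refl
  share-∼ (inj₁ (inj₂ refl)) = _ , _ , _ , inj₂ refl , inj₂ refl
  share-∼ (inj₂ (inj₁ refl)) = _ , _ , _ , inj₁ refl , inj₁ refl
  share-∼ (inj₂ (inj₂ refl)) = _ , _ , _ , inj₁ refl , inj₂ refl

module Simulation {n : ℕ} (G : Graph n) where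

  open UnorderedPair (_≟_ {n})

  V : Set
  V = Fin n

  Pair : Set
  Pair = V × V

  ends : Edge G → Pair
  ends = endpoints {G = G}

  adj? : ∀ a b → Dec (Adj G a b)
  adj? a b = T? (adj G a b)

  adj-irrefl : ∀ {a b} → Adj G a b → a ≢ b
  adj-irrefl {a} a~a refl = irref G a a~a

  edge-between : ∀ {a b} → Adj G a b → Σ (Edge G) λ x → ends x ∼ (a , b)
  edge-between {a} {b} a~b with <-cmp a b
  ... | tri< a<b _ _ = ((a , b) , a<b , a~b) , inj₁ refl
  ... | tri≈ _ a≡b _ = ⊥-elim (adj-irrefl a~b a≡b)
  ... | tri> _ _ b<a = ((b , a) , b<a , Graph.sym G a b a~b) , inj₂ refl

  edge-adj : ∀ {a b} (x : Edge G) → ends x ∼ (a , b) → Adj G a b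
  edge-adj (_ , _ , a~b) (inj₁ refl) = a~b
  edge-adj (_ , _ , b~a) (inj₂ refl) = Graph.sym G _ _ b~a

  -- edges are stored with the smaller endpoint first
  edge-∼ : ∀ (x y : Edge G) → ends x ∼ ends y → ends x ≡ ends y
  edge-∼ _ _ (inj₁ eq) = eq
  edge-∼ (_ , a<b , _) (_ , c<d , _) (inj₂ refl) = ⊥-elim (<-asym a<b c<d)

  ∼-lineAdj : ∀ {e x : Edge G} {a b c} →
              ends e ∼ (a , b) → ends x ∼ (a , c) → c ≢ b → LineAdj G e x
  ∼-lineAdj e∼ab x∼ac c≢b =
    (λ e≡x → c≢b (sym (∼-unique e∼ab (subst (_∼ _) (sym e≡x) x∼ac)))) , ∼-share e∼ab x∼ac

  record State : Set where
    field
      paid : List V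
      owed : List Pair
  open State public

  cost : State → ℕ
  cost s = length (paid s) + length (owed s)

  Settled : List V → Pair → Set
  Settled P p = Black (Adj G) P (proj₁ p) × Black (Adj G) P (proj₂ p)

  Covered : State → Pair → Set
  Covered s p = Settled (paid s) p ⊎ Any (_∼ p) (owed s)

  settled-mono : ∀ {P P′ p} → P ⊆ P′ → Settled P p → Settled P′ p
  settled-mono P⊆P′ (ba , bb) = Black-mono P⊆P′ ba , Black-mono P⊆P′ bb

  settled-∼ : ∀ {P p q} → p ∼ q → Settled P p → Settled P q
  settled-∼ (inj₁ refl) sp         = sp
  settled-∼ (inj₂ refl) (ba , bb) = bb , ba

  covered-∼ : ∀ {s p q} → p ∼ q → Covered s p → Covered s q
  covered-∼ p∼q (inj₁ sp)   = inj₁ (settled-∼ p∼q sp)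
  covered-∼ p∼q (inj₂ owes) = inj₂ (Any.map (λ g∼p → ∼-trans g∼p p∼q) owes)

  infix 4 _⊑_

  record _⊑_ (s s′ : State) : Set where
    field
      paid-⊆    : paid s ⊆ paid s′
      covered-⊆ : ∀ {p} → Covered s p → Covered s′ p
      cost-≤    : cost s′ ≤ cost s
  open _⊑_ public

  ⊑-refl : ∀ {s} → s ⊑ s
  ⊑-refl = record { paid-⊆ = λ x → x ; covered-⊆ = λ c → c ; cost-≤ = ≤-reflexive refl }

  ⊑-trans : ∀ {s₁ s₂ s₃} → s₁ ⊑ s₂ → s₂ ⊑ s₃ → s₁ ⊑ s₃
  ⊑-trans h₁ h₂ = record
    { paid-⊆    = λ x → paid-⊆ h₂ (paid-⊆ h₁ x)
    ; covered-⊆ = λ c → covered-⊆ h₂ (covered-⊆ h₁ c)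
    ; cost-≤    = ≤-trans (cost-≤ h₂) (cost-≤ h₁)
    }

  Eventually : State → (State → Set) → Set
  Eventually s P = ∃ λ s′ → s ⊑ s′ × P s′

  now : ∀ {s} {P : State → Set} → P s → Eventually s P
  now p = _ , ⊑-refl , p

  infixl 1 _>>=_

  _>>=_ : ∀ {s} {P Q : State → Set} →
          Eventually s P → (∀ {s′} → s ⊑ s′ → P s′ → Eventually s′ Q) → Eventually s Q
  (_ , s⊑s₁ , p) >>= k with k s⊑s₁ p
  ... | s₂ , s₁⊑s₂ , q = s₂ , ⊑-trans s⊑s₁ s₁⊑s₂ , q

  Monotone : (State → Set) → Set
  Monotone P = ∀ {s s′} → s ⊑ s′ → P s → P s′

  eventually-all : ∀ {I : Set} {Inv : State → Set} {Q : I → State → Set} →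
                   Monotone Inv → (∀ i → Monotone (Q i)) → (∀ i {s} → Inv s → Eventually s (Q i)) →
                   (is : List I) → ∀ {s} → Inv s → Eventually s (λ s′ → All (λ i → Q i s′) is)
  eventually-all inv-mono mono step []       inv = now []
  eventually-all inv-mono mono step (i ∷ is) inv =
    step i inv >>= λ s⊑s₁ qi →
    eventually-all inv-mono mono step is (inv-mono s⊑s₁ inv) >>= λ s₁⊑s₂ qis →
    now (mono i s₁⊑s₂ qi ∷ qis)

  eventually-∀ : ∀ {Inv : State → Set} {Q : V → State → Set} →
                 Monotone Inv → (∀ v → Monotone (Q v)) → (∀ v {s} → Inv s → Eventually s (Q v)) →
                 ∀ {s} → Inv s → Eventually s (λ s′ → ∀ v → Q v s′)
  eventually-∀ inv-mono mono step inv =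
    eventually-all inv-mono mono step (allFin n) inv >>= λ _ all →
    now (λ v → All.lookup all (∈-allFin v))

  settle-star : ∀ {s z w} → Black (Adj G) (paid s) z →
                (∀ y → Adj G z y → y ≢ w → Covered s (z , y)) →
                Eventually s (λ s′ → ∀ y → Adj G z y → y ≢ w → Black (Adj G) (paid s′) y)
  settle-star {s} {z} {w} bz star = s′ , s⊑s′ , neighbours-black
    where
      Due : Pair → Set
      Due g = g ∼ (z , opposite g z) × opposite g z ≢ w

      due? : Decidable Due
      due? g = (g ∼? (z , opposite g z)) ×-dec ¬? (opposite g z ≟ w)

      due : List Pair
      due = filter due? (owed s)

      rest : List Pair
      rest = filter (∁? due?) (owed s)

      s′ : State
      s′ = record { paid = paid s ++ map (λ g → opposite g z) due ; owed = rest }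

      paid⊆ : paid s ⊆ paid s′
      paid⊆ = ∈-++⁺ˡ

      pays : ∀ {g} → g ∈ owed s → Due g → Black (Adj G) (paid s′) (opposite g z)
      pays g∈ d = initial (∈-++⁺ʳ (paid s) (∈-map⁺ _ (∈-filter⁺ due? g∈ d)))

      neighbours-black : ∀ y → Adj G z y → y ≢ w → Black (Adj G) (paid s′) y
      neighbours-black y z~y y≢w with star y z~y y≢w
      ... | inj₁ (_ , by) = Black-mono paid⊆ by
      ... | inj₂ owes with find owes
      ...   | g , g∈ , g∼zy =
        subst (Black (Adj G) (paid s′)) o≡y
          (pays g∈ (subst (λ o → g ∼ (z , o)) (sym o≡y) g∼zy , λ o≡w → y≢w (trans (sym o≡y) o≡w)))
        where o≡y = ∼-opposite g∼zy

      owed-covered : ∀ {g p} → g ∈ owed s → g ∼ p → Covered s′ p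
      owed-covered {g} g∈ g∼p with due? g
      ... | yes d@(g∼zo , _) =
        inj₁ (settled-∼ (∼-trans (∼-sym g∼zo) g∼p) (Black-mono paid⊆ bz , pays g∈ d))
      ... | no ¬d = inj₂ (lose (∈-filter⁺ (∁? due?) g∈ ¬d) g∼p)

      cost-≡ : cost s′ ≡ cost s
      cost-≡ = begin
        length (paid s ++ map _ due) + length rest
          ≡⟨ cong (_+ length rest) (length-++ (paid s)) ⟩
        length (paid s) + length (map _ due) + length rest
          ≡⟨ cong (λ k → length (paid s) + k + length rest) (length-map _ due) ⟩
        length (paid s) + length due + length rest
          ≡⟨ +-assoc (length (paid s)) _ _ ⟩
        length (paid s) + (length due + length rest)
          ≡⟨ cong (length (paid s) +_) (length-filter-∁ due? (owed s)) ⟩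
        cost s
          ∎
        where open ≡-Reasoning

      s⊑s′ : s ⊑ s′
      s⊑s′ = record
        { paid-⊆    = paid⊆
        ; covered-⊆ = λ { (inj₁ sp) → inj₁ (settled-mono paid⊆ sp)
                        ; (inj₂ owes) → let g , g∈ , g∼p = find owes in owed-covered g∈ g∼p }
        ; cost-≤    = ≤-reflexive cost-≡
        }

  pay-for : V → V → State → State
  pay-for z y s = record { paid = z ∷ paid s ; owed = filter (∁? (_∼? (z , y))) (owed s) }

  pay-for-cost : ∀ {s z y} → Any (_∼ (z , y)) (owed s) → cost (pay-for z y s) ≤ cost s
  pay-for-cost {s} {z} {y} owes = begin
    suc (length (paid s) + length rest) ≡⟨ +-suc (length (paid s)) _ ⟨
    length (paid s) + suc (length rest) ≤⟨ +-monoʳ-≤ (length (paid s)) rest<owed ⟩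
    cost s                              ∎
    where
      open Data.Nat.Properties.≤-Reasoning
      rest = filter (∁? (_∼? (z , y))) (owed s)
      rest<owed = filter-notAll (∁? (_∼? (z , y))) (owed s)
                    (Any.map (λ g∼zy g≁zy → g≁zy g∼zy) owes)

  pay-for-covered : ∀ {s z y p} → Covered s p → ¬ p ∼ (z , y) → Covered (pay-for z y s) p
  pay-for-covered (inj₁ sp)          p≁zy = inj₁ (settled-mono Any.there sp)
  pay-for-covered {z = z} {y} (inj₂ owes) p≁zy with find owes
  ... | g , g∈ , g∼p =
    inj₂ (lose (∈-filter⁺ (∁? (_∼? (z , y))) g∈ λ g∼zy → p≁zy (∼-trans (∼-sym g∼p) g∼zy)) g∼p)

  -- If zy is owed it pays for z, and z forces y once its other neighbours are settled.
  settle-vertex : ∀ {s z y} → Adj G z y → (∀ x → Adj G z x → Covered s (z , x)) →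
                  Eventually s (λ s′ → Settled (paid s′) (z , y))
  settle-vertex {s} {z} {y} z~y star with any? (_∼? (z , y)) (owed s)
  ... | no not-owed with star y z~y
  ...   | inj₁ zy-settled = now zy-settled
  ...   | inj₂ owes       = ⊥-elim (not-owed owes)
  settle-vertex {s} {z} {y} z~y star | yes owes
    with settle-star {pay-for z y s} (initial (Any.here refl))
           (λ x z~x x≢y → pay-for-covered (star x z~x) (λ zx∼zy → x≢y (∼-unique (inj₁ refl) zx∼zy)))
  ... | s′ , s₁⊑s′ , others-black = s′ , s⊑s′ , zy-settled
    where
      z∈s′ : z ∈ paid s′
      z∈s′ = paid-⊆ s₁⊑s′ (Any.here refl)

      zy-settled : Settled (paid s′) (z , y)
      zy-settled = initial z∈s′ , force (initial z∈s′) z~y others-black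

      covered-⊆′ : ∀ {p} → Covered s p → Covered s′ p
      covered-⊆′ {p} p-covered with p ∼? (z , y)
      ... | yes p∼zy = inj₁ (settled-∼ (∼-sym p∼zy) zy-settled)
      ... | no  p≁zy = covered-⊆ s₁⊑s′ (pay-for-covered p-covered p≁zy)

      s⊑s′ : s ⊑ s′
      s⊑s′ = record
        { paid-⊆    = λ x∈ → paid-⊆ s₁⊑s′ (Any.there x∈)
        ; covered-⊆ = covered-⊆′
        ; cost-≤    = ≤-trans (cost-≤ s₁⊑s′) (pay-for-cost {s} owes)
        }

  force-step : ∀ {s u v w} → Adj G u v → Adj G v w →
               (∀ y → Adj G u y → Covered s (u , y)) →
               (∀ y → Adj G v y → y ≢ w → Covered s (v , y)) →
               Eventually s (λ s′ → Settled (paid s′) (v , w))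
  force-step u~v v~w star-u star-v =
    settle-vertex u~v star-u >>= λ s⊑s₁ (_ , v-black) →
    settle-star v-black (λ y v~y y≢w → covered-⊆ s⊑s₁ (star-v y v~y y≢w)) >>= λ s₁⊑s₂ others →
    let v-black′ = Black-mono (paid-⊆ s₁⊑s₂) v-black
    in  now (v-black′ , force v-black′ v~w others)

  module _ (T : List (Edge G)) where

    seed : State
    seed = record { paid = [] ; owed = map ends T }

    CoversSeed : State → Set
    CoversSeed s = ∀ {t} → t ∈ T → Covered s (ends t)

    seed-covered : CoversSeed seed
    seed-covered t∈T = inj₂ (Any.map (λ t≡g → inj₁ (sym t≡g)) (∈-map⁺ ends t∈T))

    seed-mono : Monotone CoversSeed
    seed-mono s⊑s′ seeded t∈T = covered-⊆ s⊑s′ (seeded t∈T)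

    Coverable : Edge G → Set
    Coverable x = ∀ {s} → CoversSeed s → Eventually s (λ s′ → Covered s′ (ends x))

    line-force : ∀ {e f} → LineAdj G e f → (∀ x → LineAdj G e x → x ≢ f → Coverable x) →
                 Coverable e → Coverable f
    line-force {e} {f} (e≢f , shared) ih cover-e {s} seeded with share-∼ shared
    ... | u , v , w , e∼uv , f∼vw =
      cover-e seeded >>= λ s⊑s₁ e-covered →
      eventually-∀ inv-mono stars-mono stars-at (seed-mono s⊑s₁ seeded , e-covered) >>= λ _ stars →
      force-step u~v v~w (λ y → proj₁ (stars y)) (λ y → proj₂ (stars y)) >>= λ _ vw-settled →
      now (inj₁ (settled-∼ (∼-sym f∼vw) vw-settled))
      where
        Inv : State → Set
        Inv s = CoversSeed s × Covered s (ends e)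

        inv-mono : Monotone Inv
        inv-mono s⊑s′ (seeded′ , e-covered) = seed-mono s⊑s′ seeded′ , covered-⊆ s⊑s′ e-covered

        Stars : V → State → Set
        Stars y s = (Adj G u y → Covered s (u , y)) × (Adj G v y → y ≢ w → Covered s (v , y))

        stars-mono : ∀ y → Monotone (Stars y)
        stars-mono _ s⊑s′ (u-star , v-star) =
          (λ u~y → covered-⊆ s⊑s′ (u-star u~y)) , (λ v~y y≢w → covered-⊆ s⊑s′ (v-star v~y y≢w))

        u~v : Adj G u v
        u~v = edge-adj e e∼uv

        v~w : Adj G v w
        v~w = edge-adj f f∼vw

        u≢w : u ≢ w
        u≢w u≡w = e≢f (edge-∼ e f (∼-trans e∼uv (∼-sym f∼uv)))
          where f∼uv = subst (λ t → ends f ∼ (t , v)) (sym u≡w) (∼-swap f∼vw)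

        cover-at : ∀ {a b y s} → ends e ∼ (a , b) → Adj G a y → (∀ {x} → ends x ∼ (a , y) → x ≢ f) →
                   Inv s → Eventually s (λ s′ → Covered s′ (a , y))
        cover-at {b = b} {y} e∼ab a~y ≢f (seeded′ , e-covered) with y ≟ b
        ... | yes refl = now (covered-∼ e∼ab e-covered)
        ... | no  y≢b with edge-between a~y
        ...   | x , x∼ay =
          ih x (∼-lineAdj {e} {x} e∼ab x∼ay y≢b) (≢f x∼ay) seeded′ >>= λ _ x-covered →
          now (covered-∼ x∼ay x-covered)

        at-u : ∀ y {s} → Inv s → Eventually s (λ s′ → Adj G u y → Covered s′ (u , y))
        at-u y inv with adj? u y
        ... | no ¬u~y = now (λ u~y → ⊥-elim (¬u~y u~y))
        ... | yes u~y =
          cover-at e∼uv u~y (λ x∼uy x≡f → ∼-apart x∼uy f∼vw (adj-irrefl u~v) u≢w (cong ends x≡f)) inv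
            >>= λ _ uy-covered → now (λ _ → uy-covered)

        at-v : ∀ y {s} → Inv s → Eventually s (λ s′ → Adj G v y → y ≢ w → Covered s′ (v , y))
        at-v y inv with adj? v y | y ≟ w
        ... | no ¬v~y | _       = now (λ v~y _ → ⊥-elim (¬v~y v~y))
        ... | yes _   | yes y≡w = now (λ _ y≢w → ⊥-elim (y≢w y≡w))
        ... | yes v~y | no  y≢w =
          cover-at (∼-swap e∼uv) v~y
            (λ x∼vy x≡f → y≢w (∼-unique x∼vy (subst (_∼ (v , w)) (sym (cong ends x≡f)) f∼vw))) inv
            >>= λ _ vy-covered → now (λ _ _ → vy-covered)

        stars-at : ∀ y {s} → Inv s → Eventually s (Stars y)
        stars-at y inv =
          at-u y inv >>= λ s⊑s′ uy-covered →
          at-v y (inv-mono s⊑s′ inv) >>= λ s′⊑s″ vy-covered →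
          now ((λ u~y → covered-⊆ s′⊑s″ (uy-covered u~y)) , vy-covered)

    covers : ∀ {x} → Black (LineAdj G) T x → Coverable x
    covers (initial t∈T)                 seeded = now (seeded t∈T)
    covers {f} (force {e} black-e e~f others) =
      line-force {e} {f} e~f (λ x e~x x≢f → covers (others x e~x x≢f)) (covers black-e)

    covers-star : (∀ x → Black (LineAdj G) T x) →
                  ∀ z {s} → CoversSeed s → Eventually s (λ s′ → ∀ y → Adj G z y → Covered s′ (z , y))
    covers-star line-black z = eventually-∀ seed-mono (λ _ s⊑s′ c z~y → covered-⊆ s⊑s′ (c z~y)) at
      where
        at : ∀ y {s} → CoversSeed s → Eventually s (λ s′ → Adj G z y → Covered s′ (z , y))
        at y seeded with adj? z y
        ... | no ¬z~y = now (λ z~y → ⊥-elim (¬z~y z~y))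
        ... | yes z~y with edge-between z~y
        ...   | x , x∼zy =
          covers (line-black x) seeded >>= λ _ x-covered → now (λ _ → covered-∼ x∼zy x-covered)

    all-black : (∀ x → Black (LineAdj G) T x) → NoIsolated G →
                Eventually seed (λ s → ∀ v → Black (Adj G) (paid s) v)
    all-black line-black no-isolated =
      eventually-∀ seed-mono (λ _ s⊑s′ → Black-mono (paid-⊆ s⊑s′)) black-at seed-covered
      where
        black-at : ∀ v {s} → CoversSeed s → Eventually s (λ s′ → Black (Adj G) (paid s′) v)
        black-at v seeded =
          covers-star line-black v seeded >>= λ _ star →
          settle-vertex (proj₂ (no-isolated v)) star >>= λ _ settled →
          now (proj₁ settled)

theorem4 : ∀ {n : ℕ} (G : Graph n) → NoIsolated G →
    ∀ (T : List (Edge G)) → IsZeroForcingSet (LineAdj G) T →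
    ∃ λ (S : List _) → IsZeroForcingSet (Adj G) S × length S ≤ length T
theorem4 G no-isolated T (_ , line-black) =
  deduplicate _≟_ S ,
  (deduplicate-! _≟_ S , λ v → Black-mono (∈-deduplicate⁺ _≟_) (black v)) ,
  (begin
    length (deduplicate _≟_ S)      ≤⟨ length-deduplicate _≟_ S ⟩
    length S                        ≤⟨ m≤m+n _ _ ⟩
    cost s                          ≤⟨ cost-≤ seed⊑s ⟩
    length (map ends T)             ≡⟨ length-map ends T ⟩
    length T                        ∎)
  where
    open Simulation G
    open Data.Nat.Properties.≤-Reasoning

    reached : Eventually (seed T) (λ s → ∀ v → Black (Adj G) (paid s) v)
    reached = all-black T line-black no-isolated

    s : State
    s = proj₁ reached

    seed⊑s : seed T ⊑ s
    seed⊑s = proj₁ (proj₂ reached)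

    black : ∀ v → Black (Adj G) (paid s) v
    black = proj₂ (proj₂ reached)

    S : List (Fin _)
    S = paid s
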